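{- For every outerplanar graph $G$ it holds that $\chi_o(G)\le 5$.
   Context: All graphs are finite, simple and undirected. A proper vertex coloring $\varphi$ of a graph $G$ is called an odd coloring if for every non-isolated vertex $x$ of $G$ there is a color $c$ such that the number of neighbors $y\in N(x)$ with $\varphi(y)=c$ is odd. The odd chromatic number $\chi_o(G)$ is the minimum number of colors in an odd coloring of $G$. -}

module Defs where

open import Data.Nat using (ℕ; _+_; _<_; _%_)
open import Data.Bool using (Bool; true; false; _∧_; if_then_else_)
open import Data.Fin using (Fin; _≟_) renaming (_<_ to _<ᶠ_)
open import Data.List using (List; map)
open import Data.Nat.ListAction using (sum)
open import Data.List using () renaming (allFin to allFinL)
open import Data.Product using (Σ; ∃; _×_; _,_)
open import Relation.Nullary using (¬_)
open import Relation.Nullary.Decidable using (⌊_⌋)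
open import Relation.Binary.PropositionalEquality using (_≡_; _≢_)
open import Function.Bundles using (_↔_; Inverse)

record Graph (n : ℕ) : Set where
  field
    adj    : Fin n → Fin n → Bool
    sym    : ∀ x y → adj x y ≡ adj y x
    irrefl : ∀ x → adj x x ≡ false
open Graph public

-- Outerplanar: the vertices can be placed on a circle (given by a bijection
-- pos : positions ↔ vertices) such that no two edges (drawn as chords) cross,
-- i.e. there are no positions p < q < r < s with edges {p,r} and {q,s}.
-- This is the combinatorial form of "planar embedding with all vertices on
-- the outer face".
Outerplanar : ∀ {n} → Graph n → Set
Outerplanar {n} G = Σ (Fin n ↔ Fin n) λ pos →
  let v = Inverse.to pos in
  ∀ (p q r s : Fin n) → p <ᶠ q → q <ᶠ r → r <ᶠ s →
    ¬ (adj G (v p) (v r) ≡ true × adj G (v q) (v s) ≡ true)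

countB : ∀ {n} → (Fin n → Bool) → ℕ
countB {n} P = sum (map (λ y → if P y then 1 else 0) (allFinL n))

Proper : ∀ {n k} → Graph n → (Fin n → Fin k) → Set
Proper G φ = ∀ x y → adj G x y ≡ true → φ x ≢ φ y

NonIsolated : ∀ {n} → Graph n → Fin n → Set
NonIsolated G x = ∃ λ y → adj G x y ≡ true

nbrCount : ∀ {n k} → Graph n → (Fin n → Fin k) → Fin n → Fin k → ℕ
nbrCount G φ x c = countB (λ y → adj G x y ∧ ⌊ φ y ≟ c ⌋)

OddColoring : ∀ {n k} → Graph n → (Fin n → Fin k) → Set
OddColoring G φ = Proper G φ ×
  (∀ x → NonIsolated G x → ∃ λ c → nbrCount G φ x c % 2 ≡ 1)

-- χ_o(G) ≤ k  ⇔  G has an odd coloring using (at most) k colours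
OddColorable : ∀ {n} → Graph n → ℕ → Set
OddColorable {n} G k = Σ (Fin n → Fin k) λ φ → OddColoring G φ

module Submission where

-- We build a proper conflict-free (PCF) colouring with five colours: a proper colouring in
-- which every non-isolated vertex x has a neighbour whose colour occurs exactly once in N(x),
-- so that colour has the odd count 1.  Unlike oddness, this property can be maintained when a
-- deleted vertex is added back, so it is built by induction on induced subgraphs.  Every
-- nonempty induced subgraph of an outerplanar graph contains a vertex v with N(v) ⊆ {a, b}
-- where a = b or a ~ b, or two vertices v ≠ w with N(v) ⊆ {a, w} and N(w) ⊆ {v, z}.  Colour
-- the rest, then give v a colour avoiding those of its neighbours and of their unique-colour
-- witnesses (four colours); in the second case colour w first, avoiding also the colour of a,
-- so that the neighbours of v get distinct colours.
--
-- To find the configuration, place the vertices in circular order so that edges are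
-- non-crossing chords.  A chord a–b confines the neighbours of every vertex under it to
-- [a, b].  Let x be the first vertex under a–b: its only back-neighbour is a, and unless a
-- chord from x encloses further vertices (then recurse under that chord) it has at most one
-- forward neighbour y.  If a ~ y, x is the first configuration; otherwise y's only
-- back-neighbour is x and, unless a chord from y encloses vertices, x and y form the second.

open import Defs hiding (sym)
open import Data.Nat as ℕ using (ℕ; zero; suc; _+_; _%_; z<s)
import Data.Nat.Properties as ℕ
open import Data.Bool as Bool using (Bool; true; _∧_; if_then_else_)
open import Data.Bool.Properties using (¬-not)
open import Data.Fin using (Fin; zero; suc; _<_; _>_; _≟_; fromℕ<)
open import Data.Fin.Properties
  using (<-cmp; <-trans; <⇒≢; _<?_; any?; ¬∀⟶∃¬; injective⇒≤; suc-injective)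
open import Data.Fin.Induction using (<-wellFounded; >-wellFounded)
open import Data.Fin.Subset using (Subset; _∈_; _-_; _⊂_; ⊤; Nonempty; Empty)
open import Data.Fin.Subset.Properties
  using (_∈?_; nonempty?; ∈⊤; x∈p∧x≢y⇒x∈p-y; p─q⊆p; x∈p⇒p-x⊂p; ⊆-⊂-trans)
open import Data.Fin.Subset.Induction using (⊂-wellFounded)
open import Data.List using (map; tabulate)
open import Data.List.Properties using (map-tabulate)
open import Data.Nat.ListAction using (sum)
import Data.Vec.Base as Vec
open import Data.Vec.Functional using (Vector; []; _∷_; updateAt)
open import Data.Vec.Functional.Properties using (updateAt-updates; updateAt-minimal)
open import Data.Product using (∃; _×_; _,_; proj₁; proj₂; map₂)
open import Data.Sum using (_⊎_; inj₁; inj₂)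
open import Data.Empty using (⊥-elim)
open import Function using (_∘_; id; const)
open import Function.Bundles using (_↔_; Inverse)
open import Induction.WellFounded using (Acc; acc)
open import Relation.Binary.Definitions using (tri<; tri≈; tri>)
open import Relation.Binary.PropositionalEquality
open import Relation.Nullary using (¬_; Dec; yes; no; contradiction)
open import Relation.Nullary.Decidable using (⌊_⌋; _×-dec_; isYes≗does; dec-true)
open import Relation.Unary using (Pred; Decidable)

private
  variable
    m n k : ℕ

module GraphNotions (G : Graph n) where

  private
    variable
      a b v x y : Fin n

  infix 4 _~_
  _~_ : Fin n → Fin n → Set
  x ~ y = adj G x y ≡ true

  _~?_ : ∀ x y → Dec (x ~ y)
  x ~? y = adj G x y Bool.≟ true

  ~-sym : x ~ y → y ~ x
  ~-sym {x} {y} x~y = trans (Graph.sym G y x) x~y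

  ~-irrefl : ¬ x ~ x
  ~-irrefl {x} x~x = contradiction (trans (sym x~x) (irrefl G x)) λ ()

  ~⇒≢ : x ~ y → x ≢ y
  ~⇒≢ x~y refl = ~-irrefl x~y

  HasNbr : Subset n → Fin n → Set
  HasNbr S x = ∃ λ y → y ∈ S × x ~ y

  hasNbr? : ∀ S x → Dec (HasNbr S x)
  hasNbr? S x = any? (λ y → y ∈? S ×-dec x ~? y)

  Nbrs⊆ : Subset n → Fin n → Fin n → Fin n → Set
  Nbrs⊆ S v a b = ∀ {y} → y ∈ S → v ~ y → y ≡ a ⊎ y ≡ b

  data Reducible (S : Subset n) : Set where
    simplicial : v ∈ S → a ≡ b ⊎ a ~ b → Nbrs⊆ S v a b → Reducible S
    paired     : ∀ {w z} → v ∈ S → w ∈ S → v ≢ w → Nbrs⊆ S v a w → Nbrs⊆ S w v z →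
                 Reducible S

  RainbowNbhd : Subset n → (Fin n → Fin k) → Fin n → Set
  RainbowNbhd S φ v = ∀ {y y′} → y ∈ S → y′ ∈ S → v ~ y → v ~ y′ → φ y ≡ φ y′ → y ≡ y′

  UniqueColourNbr : Subset n → (Fin n → Fin k) → Fin n → Fin n → Set
  UniqueColourNbr S φ x y = y ∈ S × x ~ y × (∀ {u} → u ∈ S → x ~ u → φ u ≡ φ y → u ≡ y)

  record PCFColouring (k : ℕ) (S : Subset n) : Set where
    field
      colour       : Fin n → Fin k
      witness      : Fin n → Fin n
      proper       : x ∈ S → y ∈ S → x ~ y → colour x ≢ colour y
      conflictFree : x ∈ S → HasNbr S x → UniqueColourNbr S colour x (witness x)

∃⇒least : ∀ {p} {P : Pred (Fin n) p} → Decidable P → ∃ P →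
          ∃ λ x → P x × (∀ {y} → y < x → ¬ P y)
∃⇒least {P = P} P? (x , px) = go (<-wellFounded x) px
  where
  go : ∀ {x} → Acc _<_ x → P x → ∃ λ x → P x × (∀ {y} → y < x → ¬ P y)
  go {x} (acc rs) px with any? (λ y → y <? x ×-dec P? y)
  ... | yes (y , y<x , py) = go (rs y<x) py
  ... | no none            = x , px , λ y<x py → none (_ , y<x , py)

Noncrossing : Graph n → Set
Noncrossing {n} G = ∀ (p q r s : Fin n) → p < q → q < r → r < s →
                    ¬ (adj G p r ≡ true × adj G q s ≡ true)

relabel : Graph n → (Fin m → Fin n) → Graph m
relabel G f = record
  { adj    = λ x y → adj G (f x) (f y)
  ; sym    = λ x y → Graph.sym G (f x) (f y)
  ; irrefl = λ x → irrefl G (f x)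
  }

module Reduction (G : Graph n) (noncrossing : Noncrossing G) (S : Subset n) where
  open GraphNotions G

  private
    variable
      a b p q s t u x y : Fin n

  confined : a ~ b → a < t → t < b → t ~ s → ¬ s < a × ¬ b < s
  confined a~b a<t t<b t~s =
      (λ s<a → noncrossing _ _ _ _ s<a a<t t<b (~-sym t~s , a~b))
    , (λ b<s → noncrossing _ _ _ _ a<t t<b b<s (a~b , t~s))

  Between : Fin n → Fin n → Fin n → Set
  Between a b t = t ∈ S × a < t × t < b

  between? : ∀ a b t → Dec (Between a b t)
  between? a b t = t ∈? S ×-dec a <? t ×-dec t <? b

  Least : Fin n → Fin n → Fin n → Set
  Least a b x = Between a b x × (∀ {t} → t < x → ¬ Between a b t)

  FwdNbr : Fin n → Fin n → Set
  FwdNbr u y = y ∈ S × u < y × u ~ y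

  fwdNbr? : ∀ u y → Dec (FwdNbr u y)
  fwdNbr? u y = y ∈? S ×-dec u <? y ×-dec u ~? y

  SpansRegion : Fin n → Set
  SpansRegion u = ∃ λ y → FwdNbr u y × ∃ (Between u y)

  spansRegion? : ∀ u → Dec (SpansRegion u)
  spansRegion? u = any? (λ y → fwdNbr? u y ×-dec any? (between? u y))

  BackNbrs⊆ : Fin n → Fin n → Set
  BackNbrs⊆ u p = ∀ {s} → s ∈ S → u ~ s → s < u → s ≡ p

  FwdNbrs⊆ : Fin n → Fin n → Set
  FwdNbrs⊆ u q = ∀ {y} → FwdNbr u y → y ≡ q

  nbrs⊆ : BackNbrs⊆ u p → FwdNbrs⊆ u q → Nbrs⊆ S u p q
  nbrs⊆ {u} back fwd {s} s∈S u~s with <-cmp s u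
  ... | tri< s<u _ _ = inj₁ (back s∈S u~s s<u)
  ... | tri≈ _ refl _ = ⊥-elim (~-irrefl u~s)
  ... | tri> _ _ u<s = inj₂ (fwd (s∈S , u<s , u~s))

  fwd-unique : ¬ SpansRegion u → FwdNbr u y → FwdNbrs⊆ u y
  fwd-unique {y = y} ¬spans fy@(y∈S , u<y , _) {y′} fy′@(y′∈S , u<y′ , _) with <-cmp y′ y
  ... | tri< y′<y _ _ = ⊥-elim (¬spans (y , fy , y′ , y′∈S , u<y′ , y′<y))
  ... | tri≈ _ y′≡y _ = y′≡y
  ... | tri> _ _ y<y′ = ⊥-elim (¬spans (y′ , fy′ , y , y∈S , u<y , y<y′))

  fwd-partner : ¬ SpansRegion u → (∀ {q} → FwdNbrs⊆ u q) ⊎ ∃ λ y → FwdNbr u y × FwdNbrs⊆ u y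
  fwd-partner {u} ¬spans with any? (fwdNbr? u)
  ... | yes (y , fy) = inj₂ (y , fy , fwd-unique ¬spans fy)
  ... | no none      = inj₁ λ fy → ⊥-elim (none (_ , fy))

  fwd-bound : ¬ SpansRegion u → ∃ (FwdNbrs⊆ u)
  fwd-bound {u} ¬spans with fwd-partner ¬spans
  ... | inj₁ no-fwd           = u , no-fwd
  ... | inj₂ (y , _ , y-only) = y , y-only

  below-least : a ~ b → Least a b x → a < t → t < b → s ∈ S → t ~ s → s < x → s ≡ a
  below-least {a} {s = s} a~b ((_ , _ , x<b) , x-least) a<t t<b s∈S t~s s<x with <-cmp a s
  ... | tri< a<s _ _ = ⊥-elim (x-least s<x (s∈S , a<s , <-trans s<x x<b))
  ... | tri≈ _ a≡s _ = sym a≡s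
  ... | tri> _ _ s<a = ⊥-elim (proj₁ (confined a~b a<t t<b t~s) s<a)

  least-back : a ~ b → Least a b x → BackNbrs⊆ x a
  least-back a~b least@((_ , a<x , x<b) , _) = below-least a~b least a<x x<b

  partner-below : a ~ b → Between a b x → x ~ y → ¬ a ~ y → y < b
  partner-below {y = y} a~b (_ , a<x , x<b) x~y ¬a~y with <-cmp y _
  ... | tri< y<b _ _ = y<b
  ... | tri≈ _ refl _ = ⊥-elim (¬a~y a~b)
  ... | tri> _ _ b<y = ⊥-elim (proj₂ (confined a~b a<x x<b x~y) b<y)

  partner-back : a ~ b → Least a b x → ¬ SpansRegion x → FwdNbr x y → ¬ a ~ y → BackNbrs⊆ y x
  partner-back {x = x} a~b least@(x-between@(_ , a<x , _) , _) ¬spans fy@(_ , x<y , x~y)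
               ¬a~y {s} s∈S y~s s<y with <-cmp s x
  ... | tri≈ _ s≡x _ = s≡x
  ... | tri> _ _ x<s = ⊥-elim (¬spans (_ , fy , s , s∈S , x<s , s<y))
  ... | tri< s<x _ _ = ⊥-elim (¬a~y (~-sym (subst (_ ~_) s≡a y~s)))
    where
    y<b = partner-below a~b x-between x~y ¬a~y
    s≡a = below-least a~b least (<-trans a<x x<y) y<b s∈S y~s s<x

  minimum-back : (∀ {s} → s < x → ¬ s ∈ S) → BackNbrs⊆ x p
  minimum-back x-least s∈S _ s<x = ⊥-elim (x-least s<x s∈S)

  reduce-region : Acc _>_ a → a ~ b → ∃ (Between a b) → Reducible S
  reduce-region {a} {b} (acc rs) a~b inner
    with x , least@((x∈S , a<x , _) , _) ← ∃⇒least (between? a b) inner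
    with spansRegion? x
  ... | yes (_ , (_ , _ , x~y) , inner′) = reduce-region (rs a<x) x~y inner′
  ... | no ¬spans-x with fwd-partner ¬spans-x
  ... | inj₁ no-fwd = simplicial x∈S (inj₁ refl) (nbrs⊆ (least-back a~b least) no-fwd)
  ... | inj₂ (y , fy@(y∈S , x<y , _) , x-fwd) with a ~? y
  ... | yes a~y = simplicial x∈S (inj₂ a~y) (nbrs⊆ (least-back a~b least) x-fwd)
  ... | no ¬a~y with spansRegion? y
  ... | yes (_ , (_ , _ , y~z) , inner″) = reduce-region (rs (<-trans a<x x<y)) y~z inner″
  ... | no ¬spans-y =
    paired x∈S y∈S (<⇒≢ x<y) (nbrs⊆ (least-back a~b least) x-fwd)
      (nbrs⊆ (partner-back a~b least ¬spans-x fy ¬a~y) (proj₂ (fwd-bound ¬spans-y)))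

  reducible : Nonempty S → Reducible S
  reducible nonempty with x , x∈S , x-least ← ∃⇒least (_∈? S) nonempty with spansRegion? x
  ... | yes (_ , (_ , _ , x~y) , inner) = reduce-region (>-wellFounded x) x~y inner
  ... | no ¬spans =
    simplicial x∈S (inj₁ refl) (nbrs⊆ (minimum-back x-least) (proj₂ (fwd-bound ¬spans)))

fresh : m ℕ.< k → (cs : Vector (Fin k) m) → ∃ λ c → ∀ i → c ≢ cs i
fresh {m} {k} m<k cs =
  map₂ (λ c-missed i c≡csi → c-missed (i , sym c≡csi))
       (¬∀⟶∃¬ k (λ c → ∃ λ i → cs i ≡ c) (λ c → any? (λ i → cs i ≟ c)) cs-not-onto)
  where
  cs-not-onto : ¬ (∀ c → ∃ λ i → cs i ≡ c)
  cs-not-onto onto = ℕ.<⇒≱ m<k (injective⇒≤ {f = proj₁ ∘ onto} λ {c} {c′} i≡i′ →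
    trans (sym (proj₂ (onto c))) (trans (cong cs i≡i′) (proj₂ (onto c′))))

x∈p-y⇒x≢y : ∀ {p : Subset n} {x y} → x ∈ p - y → x ≢ y
x∈p-y⇒x≢y {p = _ Vec.∷ _} {x = suc x} (Vec.there x∈p-y) refl = x∈p-y⇒x≢y x∈p-y refl

module Extension (G : Graph n) (4<k : 4 ℕ.< k) where
  open GraphNotions G

  private
    variable
      a b v w z : Fin n
      S : Subset n

  module _ (v∈S : v ∈ S) (χ : PCFColouring k (S - v)) where
    open PCFColouring χ

    Avoids : Fin k → Set
    Avoids c = ∀ {y} → y ∈ S - v → v ~ y → c ≢ colour y × c ≢ colour (witness y)

    module Extend (c : Fin k) (avoids : Avoids c) (rainbow : RainbowNbhd (S - v) colour v) where

      colour′ : Fin n → Fin k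
      colour′ = updateAt colour v (const c)

      colour′-v : colour′ v ≡ c
      colour′-v = updateAt-updates v colour

      colour′-other : ∀ {u} → u ≢ v → colour′ u ≡ colour u
      colour′-other {u} u≢v = updateAt-minimal u v colour u≢v

      colour′-on-S-v : ∀ {u} → u ∈ S - v → colour′ u ≡ colour u
      colour′-on-S-v = colour′-other ∘ x∈p-y⇒x≢y

      witness′ : Fin n → Fin n
      witness′ x with x ≟ v | hasNbr? (S - v) x
      ... | yes _ | yes (y , _) = y
      ... | no _  | yes _       = witness x
      ... | _     | no _        = v

      only-v : ∀ {x u} → ¬ HasNbr (S - v) x → u ∈ S → x ~ u → u ≡ v
      only-v {u = u} none u∈S x~u with u ≟ v
      ... | yes u≡v = u≡v
      ... | no u≢v  = ⊥-elim (none (u , x∈p∧x≢y⇒x∈p-y u∈S u≢v , x~u))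

      v-proper : ∀ {y} → y ∈ S - v → v ~ y → colour′ v ≢ colour′ y
      v-proper y∈S-v v~y eq =
        proj₁ (avoids y∈S-v v~y) (trans (sym colour′-v) (trans eq (colour′-on-S-v y∈S-v)))

      proper′ : ∀ {x y} → x ∈ S → y ∈ S → x ~ y → colour′ x ≢ colour′ y
      proper′ {x} {y} x∈S y∈S x~y with x ≟ v | y ≟ v
      ... | yes refl | yes refl = ⊥-elim (~-irrefl x~y)
      ... | yes refl | no y≢v   = v-proper (x∈p∧x≢y⇒x∈p-y y∈S y≢v) x~y
      ... | no x≢v   | yes refl = v-proper (x∈p∧x≢y⇒x∈p-y x∈S x≢v) (~-sym x~y) ∘ sym
      ... | no x≢v   | no y≢v   = λ eq →
        proper (x∈p∧x≢y⇒x∈p-y x∈S x≢v) (x∈p∧x≢y⇒x∈p-y y∈S y≢v) x~y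
          (trans (sym (colour′-other x≢v)) (trans eq (colour′-other y≢v)))

      v-unique : ∀ {y} → y ∈ S - v → v ~ y → UniqueColourNbr S colour′ v y
      v-unique {y} y∈S-v v~y = p─q⊆p _ _ y∈S-v , v~y , λ {u} u∈S v~u eq →
        let u∈S-v = x∈p∧x≢y⇒x∈p-y u∈S (~⇒≢ v~u ∘ sym) in
        rainbow u∈S-v y∈S-v v~u v~y
          (trans (sym (colour′-on-S-v u∈S-v)) (trans eq (colour′-on-S-v y∈S-v)))

      witness-stays : ∀ {x} → x ∈ S - v → HasNbr (S - v) x →
                      UniqueColourNbr S colour′ x (witness x)
      witness-stays {x} x∈S-v x-nbr with conflictFree x∈S-v x-nbr
      ... | w∈S-v , x~w , unique = p─q⊆p _ _ w∈S-v , x~w , still-unique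
        where
        still-unique : ∀ {u} → u ∈ S → x ~ u → colour′ u ≡ colour′ (witness x) → u ≡ witness x
        still-unique {u} u∈S x~u eq with u ≟ v
        ... | yes refl = ⊥-elim (proj₂ (avoids x∈S-v (~-sym x~u))
                           (trans (sym colour′-v) (trans eq (colour′-on-S-v w∈S-v))))
        ... | no u≢v   = unique (x∈p∧x≢y⇒x∈p-y u∈S u≢v) x~u
                           (trans (sym (colour′-other u≢v)) (trans eq (colour′-on-S-v w∈S-v)))

      conflictFree′ : ∀ {x} → x ∈ S → HasNbr S x → UniqueColourNbr S colour′ x (witness′ x)
      conflictFree′ {x} x∈S (y , y∈S , x~y) with x ≟ v | hasNbr? (S - v) x
      ... | yes refl | yes (_ , y′∈S-v , v~y′) = v-unique y′∈S-v v~y′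
      ... | yes refl | no none = ⊥-elim (~⇒≢ x~y (sym (only-v none y∈S x~y)))
      ... | no x≢v   | yes x-nbr = witness-stays (x∈p∧x≢y⇒x∈p-y x∈S x≢v) x-nbr
      ... | no x≢v   | no none =
        v∈S , subst (x ~_) (only-v none y∈S x~y) x~y , λ u∈S x~u _ → only-v none u∈S x~u

      colouring : PCFColouring k S
      colouring = record
        { colour = colour′ ; witness = witness′ ; proper = proper′ ; conflictFree = conflictFree′ }

    extend-deg2 : Nbrs⊆ S v a b → (a ∈ S - v → b ∈ S - v → colour a ≡ colour b → a ≡ b) →
                  PCFColouring k S
    extend-deg2 {a} {b} nbrs distinct = Extend.colouring c avoids rainbow
      where
      c-fresh = fresh 4<k (colour a ∷ colour b ∷ colour (witness a) ∷ colour (witness b) ∷ [])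
      c = proj₁ c-fresh

      nbrs′ : Nbrs⊆ (S - v) v a b
      nbrs′ = nbrs ∘ p─q⊆p _ _

      avoids : Avoids c
      avoids y∈S-v v~y with nbrs′ y∈S-v v~y
      ... | inj₁ refl = proj₂ c-fresh zero , proj₂ c-fresh (suc (suc zero))
      ... | inj₂ refl = proj₂ c-fresh (suc zero) , proj₂ c-fresh (suc (suc (suc zero)))

      rainbow : RainbowNbhd (S - v) colour v
      rainbow y∈S-v y′∈S-v v~y v~y′ eq with nbrs′ y∈S-v v~y | nbrs′ y′∈S-v v~y′
      ... | inj₁ refl | inj₁ refl = refl
      ... | inj₁ refl | inj₂ refl = distinct y∈S-v y′∈S-v eq
      ... | inj₂ refl | inj₁ refl = sym (distinct y′∈S-v y∈S-v (sym eq))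
      ... | inj₂ refl | inj₂ refl = refl

    extend-simplicial : a ≡ b ⊎ a ~ b → Nbrs⊆ S v a b → PCFColouring k S
    extend-simplicial (inj₁ a≡b) nbrs = extend-deg2 nbrs λ _ _ _ → a≡b
    extend-simplicial (inj₂ a~b) nbrs =
      extend-deg2 nbrs λ a∈S-v b∈S-v → ⊥-elim ∘ proper a∈S-v b∈S-v a~b

  extend-paired : v ∈ S → w ∈ S → v ≢ w → Nbrs⊆ S v a w → Nbrs⊆ S w v z →
                  PCFColouring k (S - v - w) → PCFColouring k S
  extend-paired {v} {S} {w} {a} {z} v∈S w∈S v≢w v-nbrs w-nbrs χ =
    extend-deg2 v∈S χ′ v-nbrs a-w-distinct
    where
    open PCFColouring χ

    w-leaf : ∀ {y} → y ∈ S - v - w → w ~ y → y ≡ z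
    w-leaf y∈S-v-w w~y with w-nbrs (p─q⊆p _ _ (p─q⊆p _ _ y∈S-v-w)) w~y
    ... | inj₁ y≡v = ⊥-elim (x∈p-y⇒x≢y (p─q⊆p _ _ y∈S-v-w) y≡v)
    ... | inj₂ y≡z = y≡z

    c-fresh = fresh (ℕ.<⇒≤ 4<k) (colour z ∷ colour (witness z) ∷ colour a ∷ [])
    c = proj₁ c-fresh

    avoids : ∀ {y} → y ∈ S - v - w → w ~ y → c ≢ colour y × c ≢ colour (witness y)
    avoids y∈S-v-w w~y rewrite w-leaf y∈S-v-w w~y =
      proj₂ c-fresh zero , proj₂ c-fresh (suc zero)

    rainbow : RainbowNbhd (S - v - w) colour w
    rainbow y∈ y′∈ w~y w~y′ _ = trans (w-leaf y∈ w~y) (sym (w-leaf y′∈ w~y′))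

    χ′ = Extend.colouring (x∈p∧x≢y⇒x∈p-y w∈S (v≢w ∘ sym)) χ c avoids rainbow

    a-w-distinct : a ∈ S - v → w ∈ S - v →
                   PCFColouring.colour χ′ a ≡ PCFColouring.colour χ′ w → a ≡ w
    a-w-distinct _ _ eq with a ≟ w
    ... | yes a≡w = a≡w
    ... | no a≢w  = ⊥-elim (proj₂ c-fresh (suc (suc zero)) (sym (begin
      colour a                       ≡⟨ updateAt-minimal a w colour a≢w ⟨
      PCFColouring.colour χ′ a       ≡⟨ eq ⟩
      PCFColouring.colour χ′ w       ≡⟨ updateAt-updates w colour ⟩
      c                              ∎)))
      where open ≡-Reasoning

  empty-colouring : Empty S → PCFColouring k S
  empty-colouring empty = record
    { colour       = const (fromℕ< (ℕ.<-trans z<s 4<k))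
    ; witness      = id
    ; proper       = λ x∈S → ⊥-elim (empty (_ , x∈S))
    ; conflictFree = λ x∈S → ⊥-elim (empty (_ , x∈S))
    }

  pcfColouring : (∀ {S} → Nonempty S → Reducible S) → PCFColouring k ⊤
  pcfColouring reducible = colour-from (⊂-wellFounded ⊤)
    where
    colour-from : ∀ {S} → Acc _⊂_ S → PCFColouring k S
    colour-from {S} (acc rs) with nonempty? S
    ... | no empty = empty-colouring empty
    ... | yes nonempty with reducible nonempty
    ... | simplicial v∈S ab nbrs =
      extend-simplicial v∈S (colour-from (rs (x∈p⇒p-x⊂p v∈S))) ab nbrs
    ... | paired v∈S w∈S v≢w v-nbrs w-nbrs =
      extend-paired v∈S w∈S v≢w v-nbrs w-nbrs
        (colour-from (rs (⊆-⊂-trans (p─q⊆p _ _) (x∈p⇒p-x⊂p v∈S))))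

module _ (G : Graph n) (σ : Fin n ↔ Fin n) where
  open Inverse σ using (to; from; strictlyInverseˡ; strictlyInverseʳ)
  open GraphNotions G
  private module H = GraphNotions (relabel G to)

  ~⇒~from : ∀ {x y} → x ~ y → from x H.~ from y
  ~⇒~from {x} {y} = subst₂ _~_ (sym (strictlyInverseˡ x)) (sym (strictlyInverseˡ y))

  ~from⇒~ : ∀ {x p} → from x H.~ p → x ~ to p
  ~from⇒~ {x} = subst (_~ _) (strictlyInverseˡ x)

  PCFColouring-from-relabel : H.PCFColouring k ⊤ → PCFColouring k ⊤
  PCFColouring-from-relabel χ = record
    { colour       = colour ∘ from
    ; witness      = to ∘ witness ∘ from
    ; proper       = λ _ _ x~y → proper ∈⊤ ∈⊤ (~⇒~from x~y)
    ; conflictFree = λ { {x} _ (y , _ , x~y) →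
                         unique-at x (conflictFree ∈⊤ (from y , ∈⊤ , ~⇒~from x~y)) }
    }
    where
    open H.PCFColouring χ
    unique-at : ∀ x → H.UniqueColourNbr ⊤ colour (from x) (witness (from x)) →
                UniqueColourNbr ⊤ (colour ∘ from) x (to (witness (from x)))
    unique-at x (_ , x~w , unique) = ∈⊤ , ~from⇒~ x~w , λ {u} _ x~u eq →
      trans (sym (strictlyInverseˡ u))
        (cong to (unique ∈⊤ (~⇒~from x~u) (trans eq (cong colour (strictlyInverseʳ _)))))

countB-suc : (P : Fin (suc n) → Bool) →
             countB P ≡ (if P zero then 1 else 0) + countB (P ∘ suc)
countB-suc P = cong (λ xs → (if P zero then 1 else 0) + sum xs)
  (trans (map-tabulate suc indicator) (sym (map-tabulate id (indicator ∘ suc))))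
  where
  indicator = λ y → if P y then 1 else 0

countB-none : (P : Fin n → Bool) → (∀ x → P x ≢ true) → countB P ≡ 0
countB-none {zero}  P none = refl
countB-none {suc n} P none rewrite countB-suc P | ¬-not (none zero) =
  countB-none (P ∘ suc) (none ∘ suc)

countB-unique : (P : Fin n → Bool) {y : Fin n} → P y ≡ true → (∀ {x} → P x ≡ true → x ≡ y) →
                countB P ≡ 1
countB-unique {suc n} P {zero} Py≡true unique rewrite countB-suc P | Py≡true =
  cong suc (countB-none (P ∘ suc) λ x Psx → contradiction (unique Psx) λ ())
countB-unique {suc n} P {suc y} Py≡true unique
  rewrite countB-suc P | ¬-not {P zero} (λ P0 → contradiction (unique P0) λ ()) =
  countB-unique (P ∘ suc) Py≡true (suc-injective ∘ unique)

∧-isYes : ∀ {A : Set} {b} (a? : Dec A) → b ≡ true → A → b ∧ ⌊ a? ⌋ ≡ true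
∧-isYes a? refl a = trans (isYes≗does a?) (dec-true a? a)

∧-isYes⁻ : ∀ {A : Set} {b} (a? : Dec A) → b ∧ ⌊ a? ⌋ ≡ true → b ≡ true × A
∧-isYes⁻ {b = true} (yes a) _ = refl , a

module _ (G : Graph n) where
  open GraphNotions G

  PCF⇒odd : (χ : PCFColouring k ⊤) → OddColoring G (PCFColouring.colour χ)
  PCF⇒odd χ = (λ _ _ → proper ∈⊤ ∈⊤) , λ x (y , x~y) →
    colour (witness x) , cong (_% 2) (witness-colour-once (conflictFree ∈⊤ (y , ∈⊤ , x~y)))
    where
    open PCFColouring χ
    witness-colour-once : ∀ {x} → UniqueColourNbr ⊤ colour x (witness x) →
                          nbrCount G colour x (colour (witness x)) ≡ 1
    witness-colour-once (_ , x~w , unique) =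
      countB-unique _ (∧-isYes (colour _ ≟ colour _) x~w refl) λ x~u∧same →
        let x~u , same = ∧-isYes⁻ (colour _ ≟ colour _) x~u∧same in unique ∈⊤ x~u same

proposition2 : ∀ (n : ℕ) (G : Graph n) → Outerplanar G → OddColorable G 5
proposition2 n G (σ , noncrossing) =
  GraphNotions.PCFColouring.colour χ , PCF⇒odd G χ
  where
  -- `Outerplanar G` unfolds to a bijection σ with `Noncrossing (relabel G (Inverse.to σ))`.
  H = relabel G (Inverse.to σ)
  χ = PCFColouring-from-relabel G σ
        (Extension.pcfColouring H (ℕ.n<1+n 4) (Reduction.reducible H noncrossing _))
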